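{- Let $D_3=(V,E)$ be the directed clique on three vertices (three vertices and all six arcs $(x,y)$, $x\neq y$). Then $D_3$ has a directed cycle and has no isolated cycle, and it is the smallest such graph: every finite loop-free directed multigraph $G'=(V',E')$ not isomorphic to $D_3$ which contains a directed cycle and has no isolated cycle satisfies $|V'|+|E'|>|V|+|E|$.
   Context: An elementary cycle is a directed cycle visiting no vertex twice, regarded as a set of arcs. For an elementary cycle $c$ of a digraph $H$, its isolating arcs are $I(c)=\{e\in c:\ c$ shares no arc with any elementary cycle $c'$ of $H$ that contains neither $e$ nor any arc parallel to $e$ (same tail and head)$\}$. An isolated cycle is an elementary cycle $c$ with $I(c)\neq\emptyset$; $O_I(H)$ denotes the set of isolated cycles, so "no isolated cycle" means $O_I(H)=\emptyset$. -}

module Defs where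

open import Data.Nat using (ℕ; _+_)
open import Data.Fin using (Fin; zero; suc)
open import Data.List using (List; []; _∷_; map)
open import Data.List.Membership.Propositional using (_∈_)
open import Data.List.Relation.Unary.Unique.Propositional using (Unique)
open import Data.Product using (Σ; ∃; _×_; _,_)
open import Data.Empty using (⊥)
open import Relation.Nullary using (¬_)
open import Relation.Binary.PropositionalEquality using (_≡_; _≢_; refl)
open import Function.Bundles using (_↔_; Inverse)

record Digraph : Set where
  field
    nV : ℕ
    nE : ℕ
    tail : Fin nE → Fin nV
    head : Fin nE → Fin nV
    loopless : ∀ e → tail e ≢ head e
open Digraph public

module _ (G : Digraph) where

  Arc : Set
  Arc = Fin (nE G)

  ChainTo : Arc → List Arc → Set
  ChainTo e₀ [] = ⊥
  ChainTo e₀ (x ∷ []) = head G x ≡ tail G e₀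
  ChainTo e₀ (x ∷ y ∷ r) = (head G x ≡ tail G y) × ChainTo e₀ (y ∷ r)

  Closed : List Arc → Set
  Closed [] = ⊥
  Closed (e ∷ es) = ChainTo e (e ∷ es)

  -- An elementary cycle, given by its arcs in cyclic order; it visits no
  -- vertex twice (the tails of its arcs, i.e. its vertices, are distinct).
  ElemCycle : List Arc → Set
  ElemCycle c = Closed c × Unique (map (tail G) c)

  Parallel : Arc → Arc → Set
  Parallel f e = (tail G f ≡ tail G e) × (head G f ≡ head G e)

  Isolating : List Arc → Arc → Set
  Isolating c e = e ∈ c ×
    (∀ c' → ElemCycle c' → (∀ f → f ∈ c' → ¬ Parallel f e) →
       ∀ f → f ∈ c' → ¬ (f ∈ c))

  IsolatedCycle : List Arc → Set
  IsolatedCycle c = ElemCycle c × ∃ λ e → Isolating c e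

  HasCycle : Set
  HasCycle = ∃ λ c → ElemCycle c

  NoIsolatedCycle : Set
  NoIsolatedCycle = ∀ c → ¬ IsolatedCycle c

record Iso (G H : Digraph) : Set where
  field
    vmap : Fin (nV G) ↔ Fin (nV H)
    amap : Fin (nE G) ↔ Fin (nE H)
    tail-pres : ∀ e → Inverse.to vmap (tail G e) ≡ tail H (Inverse.to amap e)
    head-pres : ∀ e → Inverse.to vmap (head G e) ≡ head H (Inverse.to amap e)

D3-tail : Fin 6 → Fin 3
D3-tail zero = zero
D3-tail (suc zero) = zero
D3-tail (suc (suc zero)) = suc zero
D3-tail (suc (suc (suc zero))) = suc zero
D3-tail (suc (suc (suc (suc zero)))) = suc (suc zero)
D3-tail (suc (suc (suc (suc (suc zero))))) = suc (suc zero)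

D3-head : Fin 6 → Fin 3
D3-head zero = suc zero
D3-head (suc zero) = suc (suc zero)
D3-head (suc (suc zero)) = zero
D3-head (suc (suc (suc zero))) = suc (suc zero)
D3-head (suc (suc (suc (suc zero)))) = zero
D3-head (suc (suc (suc (suc (suc zero))))) = suc zero

D3-loopless : ∀ e → D3-tail e ≢ D3-head e
D3-loopless zero ()
D3-loopless (suc zero) ()
D3-loopless (suc (suc zero)) ()
D3-loopless (suc (suc (suc zero))) ()
D3-loopless (suc (suc (suc (suc zero)))) ()
D3-loopless (suc (suc (suc (suc (suc zero))))) ()

D3 : Digraph
D3 = record { nV = 3 ; nE = 6 ; tail = D3-tail ; head = D3-head ; loopless = D3-loopless }

size : Digraph → ℕ
size G = nV G + nE G

-- D₃ has no isolated cycle: the arc following e on a cycle lies on a 2-cycle or a triangle of D₃ avoiding e.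
--
-- Conversely let G have a cycle, no isolated cycle and |V| + |E| ≤ 9, so that for every arc e of a cycle c
-- some cycle avoids e and its parallels but shares an arc with c.  If G has a 2-cycle a, b, such a cycle for a
-- passes through b, hence leaves the tail of a and re-enters its head through a third vertex; with the same
-- for b this gives three vertices and six arcs, which exhaust the budget and form a copy of D₃.  Without
-- 2-cycles a shortest cycle has length 3 or 4, since five vertices and five arcs exceed the budget.  On a
-- 4-cycle without shorter cycles every arc leaving one of its vertices runs along it, so a cycle avoiding one
-- of its arcs cannot meet it.  A cycle avoiding an arc A of a triangle must leave the triangle for a new vertex
-- and come back; triangle and detour fill the budget, so a cycle avoiding A is forced along the detour back to
-- the tail of A, from where only parallels of A lead on.

module Submission where

open import Defs
open import Data.Nat using (suc; _+_; _≤_; _<_; z≤n; s≤s)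
open import Data.Nat.Properties using (≤-trans; ≤-refl; +-mono-≤; +-monoˡ-≤; +-monoʳ-≤; +-cancelˡ-≤; +-cancelʳ-≤; 1+n≰n; ≰⇒>)
open import Data.Fin using (Fin; zero; suc; _≟_)
open import Data.Fin.Properties using (any?; all?; injective⇒≤)
open import Data.Fin.Patterns using (0F; 1F; 2F; 3F; 4F; 5F)
open import Data.List using (List; []; _∷_; map; length; lookup)
open import Data.List.Membership.Propositional using (_∈_)
open import Data.List.Membership.Propositional.Properties using (∈-lookup)
open import Data.List.Relation.Unary.Any using (here; there)
open import Data.List.Relation.Unary.All as All using (All; []; _∷_)
open import Data.List.Relation.Unary.AllPairs using ([]; _∷_)
open import Data.List.Relation.Unary.Unique.Propositional using (Unique)
open import Data.List.Relation.Unary.Unique.Propositional.Properties using (map⁻)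
open import Data.Product using (∃; _×_; _,_; proj₁; proj₂; swap)
open import Data.Sum using (_⊎_; inj₁; inj₂)
open import Data.Empty using (⊥; ⊥-elim)
open import Data.Bool using (if_then_else_)
open import Relation.Nullary using (¬_; Dec; yes; no; ¬?)
open import Relation.Nullary.Negation using (contradiction)
open import Relation.Nullary.Decidable using (_×-dec_; _→-dec_; from-yes; ⌊_⌋)
open import Relation.Binary.PropositionalEquality using (_≡_; _≢_; refl; sym; trans; cong; ≢-sym)
open import Function.Definitions using (Injective)
open import Function.Bundles using (_↔_; mk↔ₛ′)

lookup-injective : ∀ {A : Set} {xs : List A} → Unique xs → Injective _≡_ _≡_ (lookup xs)
lookup-injective (_ ∷ _) {zero} {zero} _ = refl
lookup-injective (x∉xs ∷ _) {zero} {suc j} eq = contradiction eq (All.lookup x∉xs (∈-lookup j))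
lookup-injective (x∉xs ∷ _) {suc i} {zero} eq = contradiction (sym eq) (All.lookup x∉xs (∈-lookup i))
lookup-injective (_ ∷ xs-unique) {suc i} {suc j} eq = cong suc (lookup-injective xs-unique eq)

Unique⇒length≤ : ∀ {n} {xs : List (Fin n)} → Unique xs → length xs ≤ n
Unique⇒length≤ xs-unique = injective⇒≤ (lookup-injective xs-unique)

injective⇒surjective : ∀ {m n} {f : Fin m → Fin n} → Injective _≡_ _≡_ f → n ≤ m →
                       ∀ z → ∃ λ i → f i ≡ z
injective⇒surjective {m} {n} {f} f-injective n≤m z with any? (λ i → f i ≟ z)
... | yes hit = hit
... | no miss = contradiction (≤-trans (injective⇒≤ extension-injective) n≤m) 1+n≰n
  where
  extension : Fin (suc m) → Fin n
  extension zero = z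
  extension (suc i) = f i
  extension-injective : Injective _≡_ _≡_ extension
  extension-injective {zero} {zero} _ = refl
  extension-injective {zero} {suc j} eq = contradiction (j , sym eq) miss
  extension-injective {suc i} {zero} eq = contradiction (i , eq) miss
  extension-injective {suc i} {suc j} eq = cong suc (f-injective eq)

module _ {m n} {f : Fin m → Fin n} (f-injective : Injective _≡_ _≡_ f)
         (f-surjective : ∀ z → ∃ λ i → f i ≡ z) where

  preimage : Fin n → Fin m
  preimage z = proj₁ (f-surjective z)

  preimage-cancel : ∀ i → preimage (f i) ≡ i
  preimage-cancel i = f-injective (proj₂ (f-surjective (f i)))

  preimage-↔ : Fin n ↔ Fin m
  preimage-↔ = mk↔ₛ′ preimage f preimage-cancel (λ z → proj₂ (f-surjective z))

Vertex : Digraph → Set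
Vertex G = Fin (nV G)

Joins : (G : Digraph) → Arc G → Vertex G → Vertex G → Set
Joins G e u v = tail G e ≡ u × head G e ≡ v

module _ {G H : Digraph} {ν : Vertex H → Vertex G} {α : Arc H → Arc G}
         (ν-injective : Injective _≡_ _≡_ ν) (α-injective : Injective _≡_ _≡_ α)
         (G≤H : size G ≤ size H) where

  private
    nV-G≤nV-H : nV G ≤ nV H
    nV-G≤nV-H = +-cancelʳ-≤ (nE G) (nV G) (nV H)
      (≤-trans G≤H (+-monoʳ-≤ (nV H) (injective⇒≤ α-injective)))

    nE-G≤nE-H : nE G ≤ nE H
    nE-G≤nE-H = +-cancelˡ-≤ (nV G) (nE G) (nE H)
      (≤-trans G≤H (+-monoˡ-≤ (nE H) (injective⇒≤ ν-injective)))

  vertices-enumerated : ∀ z → ∃ λ i → ν i ≡ z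
  vertices-enumerated = injective⇒surjective ν-injective nV-G≤nV-H

  arcs-enumerated : ∀ e → ∃ λ j → α j ≡ e
  arcs-enumerated = injective⇒surjective α-injective nE-G≤nE-H

  enumeration-iso : (∀ j → tail G (α j) ≡ ν (tail H j)) → (∀ j → head G (α j) ≡ ν (head H j)) →
                    Iso G H
  enumeration-iso tail-commutes head-commutes = record
    { vmap = preimage-↔ ν-injective vertices-enumerated
    ; amap = preimage-↔ α-injective arcs-enumerated
    ; tail-pres = transported tail-commutes
    ; head-pres = transported head-commutes
    }
    where
    transported : {end-G : Arc G → Vertex G} {end-H : Arc H → Vertex H} →
                  (∀ j → end-G (α j) ≡ ν (end-H j)) →
                  ∀ e → preimage ν-injective vertices-enumerated (end-G e)
                      ≡ end-H (preimage α-injective arcs-enumerated e)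
    transported {end-H = end-H} commutes e with arcs-enumerated e
    ... | j , refl = trans (cong (preimage ν-injective vertices-enumerated) (commutes j))
                           (preimage-cancel ν-injective vertices-enumerated (end-H j))

module Cycles (G : Digraph) where

  private
    t h : Arc G → Vertex G
    t = tail G
    h = head G

  chain-successor : ∀ {e₀ l x} → ChainTo G e₀ l → x ∈ l →
                    ∃ λ y → (y ∈ l ⊎ y ≡ e₀) × h x ≡ t y
  chain-successor {e₀} {_ ∷ []} chain (here refl) = e₀ , inj₂ refl , chain
  chain-successor {l = _ ∷ y ∷ _} (linked , _) (here refl) = y , inj₁ (there (here refl)) , linked
  chain-successor {l = _ ∷ _ ∷ _} (_ , chain) (there x∈l) with chain-successor chain x∈l
  ... | y , inj₁ y∈l , linked = y , inj₁ (there y∈l) , linked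
  ... | y , inj₂ y≡e₀ , linked = y , inj₂ y≡e₀ , linked

  successor : ∀ {c x} → ElemCycle G c → x ∈ c → ∃ λ y → y ∈ c × h x ≡ t y
  successor {_ ∷ _} (closed , _) x∈c with chain-successor closed x∈c
  ... | y , inj₁ y∈c , linked = y , y∈c , linked
  ... | y , inj₂ refl , linked = y , here refl , linked

  chain-last : ∀ {e₀ l} → ChainTo G e₀ l → ∃ λ y → y ∈ l × h y ≡ t e₀
  chain-last {l = x ∷ []} chain = x , here refl , chain
  chain-last {l = _ ∷ _ ∷ _} (_ , chain) with chain-last chain
  ... | y , y∈l , linked = y , there y∈l , linked

  chain-predecessor : ∀ {e₀ a l x} → ChainTo G e₀ (a ∷ l) → x ∈ l →
                      ∃ λ y → y ∈ a ∷ l × h y ≡ t x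
  chain-predecessor {a = a} {_ ∷ _} (linked , _) (here refl) = a , here refl , linked
  chain-predecessor {l = _ ∷ _} (_ , chain) (there x∈l) with chain-predecessor chain x∈l
  ... | y , y∈l , linked = y , there y∈l , linked

  predecessor : ∀ {c x} → ElemCycle G c → x ∈ c → ∃ λ y → y ∈ c × h y ≡ t x
  predecessor {_ ∷ _} (closed , _) (here refl) = chain-last closed
  predecessor {_ ∷ _} (closed , _) (there x∈c) = chain-predecessor closed x∈c

  distinct-count : (vs : List (Vertex G)) (as : List (Arc G)) → Unique vs → Unique as →
                   length vs + length as ≤ size G
  distinct-count _ _ vs-unique as-unique = +-mono-≤ (Unique⇒length≤ vs-unique) (Unique⇒length≤ as-unique)

  ≢-by-tail : ∀ {x y u u'} → t x ≡ u → t y ≡ u' → u ≢ u' → x ≢ y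
  ≢-by-tail refl refl tx≢ty refl = tx≢ty refl

  ≢-by-head : ∀ {x y v v'} → h x ≡ v → h y ≡ v' → v ≢ v' → x ≢ y
  ≢-by-head refl refl hx≢hy refl = hx≢hy refl

  Joins⇒≢ : ∀ {e u v} → Joins G e u v → u ≢ v
  Joins⇒≢ {e} (refl , refl) = loopless G e

  two-cycle-elementary : ∀ {a b u v} → Joins G a u v → Joins G b v u → ElemCycle G (a ∷ b ∷ [])
  two-cycle-elementary a-joins@(refl , ha) (refl , hb) =
    (ha , hb) , (Joins⇒≢ a-joins ∷ []) ∷ [] ∷ []

  triangle-elementary : ∀ {A B C a b c} → Joins G A a b → Joins G B b c → Joins G C c a →
                        ElemCycle G (A ∷ B ∷ C ∷ [])
  triangle-elementary A-joins@(refl , hA) B-joins@(refl , hB) C-joins@(refl , hC) =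
    (hA , hB , hC) , (Joins⇒≢ A-joins ∷ ≢-sym (Joins⇒≢ C-joins) ∷ []) ∷ (Joins⇒≢ B-joins ∷ []) ∷ [] ∷ []

  Avoids : List (Arc G) → Arc G → Set
  Avoids c e = ∀ f → f ∈ c → ¬ Parallel G f e

  escape : NoIsolatedCycle G → ∀ {c e} → ElemCycle G c → e ∈ c →
           ¬ ¬ (∃ λ c' → ElemCycle G c' × Avoids c' e × ∃ λ f → f ∈ c' × f ∈ c)
  escape noIsolated {c} c-elementary e∈c no-escape = noIsolated c
    (c-elementary , _ , e∈c , λ c' c'-elementary avoids f f∈c' f∈c →
      no-escape (c' , c'-elementary , avoids , f , f∈c' , f∈c))

module Deciding (G : Digraph) where

  open import Data.List.Relation.Unary.Unique.DecPropositional (_≟_ {nV G}) using (unique?)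
  open import Data.List.Membership.DecPropositional (_≟_ {nE G}) using (_∈?_) public

  chain? : ∀ e₀ l → Dec (ChainTo G e₀ l)
  chain? e₀ [] = no λ ()
  chain? e₀ (x ∷ []) = head G x ≟ tail G e₀
  chain? e₀ (x ∷ y ∷ l) = (head G x ≟ tail G y) ×-dec chain? e₀ (y ∷ l)

  elementary? : ∀ c → Dec (ElemCycle G c)
  elementary? [] = no λ ()
  elementary? (e ∷ c) = chain? e (e ∷ c) ×-dec unique? (map (tail G) (e ∷ c))

  parallel? : ∀ f e → Dec (Parallel G f e)
  parallel? f e = (tail G f ≟ tail G e) ×-dec (head G f ≟ head G e)

reverse-arc : Arc D3 → Arc D3
reverse-arc 0F = 2F
reverse-arc 1F = 4F
reverse-arc 2F = 0F
reverse-arc 3F = 5F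
reverse-arc 4F = 1F
reverse-arc 5F = 3F

triangle-through : Arc D3 → List (Arc D3)
triangle-through 0F = 0F ∷ 3F ∷ 4F ∷ []
triangle-through 1F = 1F ∷ 5F ∷ 2F ∷ []
triangle-through 2F = 2F ∷ 1F ∷ 5F ∷ []
triangle-through 3F = 3F ∷ 4F ∷ 0F ∷ []
triangle-through 4F = 4F ∷ 0F ∷ 3F ∷ []
triangle-through 5F = 5F ∷ 2F ∷ 1F ∷ []

cycle-through-avoiding : Arc D3 → Arc D3 → List (Arc D3)
cycle-through-avoiding g e = if ⌊ e ≟ reverse-arc g ⌋ then triangle-through g else g ∷ reverse-arc g ∷ []

cycle-through-avoiding-correct : ∀ g e → g ≢ e →
  ElemCycle D3 (cycle-through-avoiding g e) × g ∈ cycle-through-avoiding g e ×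
  All (λ f → ¬ Parallel D3 f e) (cycle-through-avoiding g e)
cycle-through-avoiding-correct = from-yes (all? λ g → all? λ e → ¬? (g ≟ e) →-dec
  (elementary? (cycle-through-avoiding g e) ×-dec (g ∈? cycle-through-avoiding g e) ×-dec
   All.all? (λ f → ¬? (parallel? f e)) (cycle-through-avoiding g e)))
  where open Deciding D3

d3-has-cycle : HasCycle D3
d3-has-cycle = 0F ∷ 2F ∷ [] , from-yes (Deciding.elementary? D3 (0F ∷ 2F ∷ []))

d3-no-isolated-cycle : NoIsolatedCycle D3
d3-no-isolated-cycle c (c-elementary , e , e∈c , isolating) =
  let g , g∈c , he≡tg = Cycles.successor D3 c-elementary e∈c
      elementary , g∈cycle , avoids = cycle-through-avoiding-correct g e λ g≡e →
        D3-loopless e (trans (cong (tail D3) (sym g≡e)) (sym he≡tg))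
  in isolating (cycle-through-avoiding g e) elementary (λ f f∈cycle → All.lookup avoids f∈cycle) g g∈cycle g∈c

record Detour (G : Digraph) (u v : Vertex G) : Set where
  field
    out : Arc G
    out-tail : tail G out ≡ u
    out-head-fresh : head G out ≢ u × head G out ≢ v
    into : Arc G
    into-head : head G into ≡ v
    into-tail-fresh : tail G into ≢ u × tail G into ≢ v

two-cycle-detour : ∀ {G} → NoIsolatedCycle G → ∀ {a b u v} → Joins G a u v → Joins G b v u →
                   ¬ ¬ Detour G u v
two-cycle-detour {G} noIsolated {a} {b} a-joins@(refl , refl) b-joins@(tb , hb) no-detour =
  escape noIsolated (two-cycle-elementary a-joins b-joins) (here refl) λ where
    (_ , _ , avoids , f , f∈c' , here refl) → avoids f f∈c' (refl , refl)
    (_ , c'-elementary , avoids , _ , f∈c' , there (here refl)) →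
      let s , s∈c' , hb≡ts = successor c'-elementary f∈c'
          p , p∈c' , hp≡tb = predecessor c'-elementary f∈c'
          ts≡u = trans (sym hb≡ts) hb
          hp≡v = trans hp≡tb tb
      in no-detour record
        { out = s ; out-tail = ts≡u
        ; out-head-fresh = (λ hs≡u → loopless G s (trans ts≡u (sym hs≡u)))
                         , (λ hs≡v → avoids s s∈c' (ts≡u , hs≡v))
        ; into = p ; into-head = hp≡v
        ; into-tail-fresh = (λ tp≡u → avoids p p∈c' (tp≡u , hp≡v))
                          , (λ tp≡v → loopless G p (trans tp≡v (sym hp≡v)))
        }
  where open Cycles G

two-cycle-detours⇒Iso-D3 : ∀ {G} → size G ≤ size D3 → ∀ {a b u v} → Joins G a u v → Joins G b v u →
                           Detour G u v → Detour G v u → Iso G D3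
two-cycle-detours⇒Iso-D3 {G} G≤D3 {a} {b} {u} {v} a-joins@(ta , ha) b-joins@(tb , hb) d₁ d₂ =
  enumeration-iso ν-injective α-injective G≤D3 (λ j → proj₁ (joins j)) (λ j → proj₂ (joins j))
  where
  open Cycles G
  module D₁ = Detour d₁
  module D₂ = Detour d₂

  w : Vertex G
  w = head G D₁.out

  u≢v : u ≢ v
  u≢v = Joins⇒≢ a-joins
  u≢w : u ≢ w
  u≢w = ≢-sym (proj₁ D₁.out-head-fresh)
  v≢w : v ≢ w
  v≢w = ≢-sym (proj₂ D₁.out-head-fresh)

  vertices : List (Vertex G)
  vertices = u ∷ v ∷ w ∷ []
  arcs : List (Arc G)
  arcs = a ∷ D₁.out ∷ b ∷ D₂.out ∷ D₂.into ∷ D₁.into ∷ []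
  ν : Fin 3 → Vertex G
  ν = lookup vertices
  α : Fin 6 → Arc G
  α = lookup arcs

  ν-injective : Injective _≡_ _≡_ ν
  ν-injective = lookup-injective ((u≢v ∷ u≢w ∷ []) ∷ (v≢w ∷ []) ∷ [] ∷ [])

  -- Only the freshness of the detour endpoints is usable here: identifying them with w needs this injectivity.
  α-injective : Injective _≡_ _≡_ α
  α-injective = lookup-injective
    ( (≢-by-head ha refl v≢w ∷ ≢-by-tail ta tb u≢v ∷ ≢-by-tail ta D₂.out-tail u≢v
        ∷ ≢-by-head ha D₂.into-head (≢-sym u≢v)
        ∷ ≢-by-tail ta refl (≢-sym (proj₁ D₁.into-tail-fresh)) ∷ [])
    ∷ (≢-by-tail D₁.out-tail tb u≢v ∷ ≢-by-tail D₁.out-tail D₂.out-tail u≢v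
        ∷ ≢-by-tail D₁.out-tail refl (≢-sym (proj₂ D₂.into-tail-fresh))
        ∷ ≢-by-tail D₁.out-tail refl (≢-sym (proj₁ D₁.into-tail-fresh)) ∷ [])
    ∷ (≢-by-head hb refl (≢-sym (proj₂ D₂.out-head-fresh))
        ∷ ≢-by-tail tb refl (≢-sym (proj₁ D₂.into-tail-fresh))
        ∷ ≢-by-head hb D₁.into-head u≢v ∷ [])
    ∷ (≢-by-tail D₂.out-tail refl (≢-sym (proj₁ D₂.into-tail-fresh))
        ∷ ≢-by-tail D₂.out-tail refl (≢-sym (proj₂ D₁.into-tail-fresh)) ∷ [])
    ∷ (≢-by-head D₂.into-head D₁.into-head u≢v ∷ [])
    ∷ [] ∷ [])

  third-vertex : ∀ {z} → z ≢ u × z ≢ v → z ≡ w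
  third-vertex {z} (z≢u , z≢v) with vertices-enumerated {G} {D3} ν-injective α-injective G≤D3 z
  ... | 0F , refl = contradiction refl z≢u
  ... | 1F , refl = contradiction refl z≢v
  ... | 2F , w≡z = sym w≡z

  s₁-joins : Joins G D₁.out u w
  s₁-joins = D₁.out-tail , refl
  s₂-joins : Joins G D₂.out v w
  s₂-joins = D₂.out-tail , third-vertex (swap D₂.out-head-fresh)
  p₂-joins : Joins G D₂.into w u
  p₂-joins = third-vertex (swap D₂.into-tail-fresh) , D₂.into-head
  p₁-joins : Joins G D₁.into w v
  p₁-joins = third-vertex D₁.into-tail-fresh , D₁.into-head

  joins : ∀ j → Joins G (α j) (ν (D3-tail j)) (ν (D3-head j))
  joins 0F = a-joins
  joins 1F = s₁-joins
  joins 2F = b-joins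
  joins 3F = s₂-joins
  joins 4F = p₂-joins
  joins 5F = p₁-joins

module Minimality {G : Digraph} (G≤D3 : size G ≤ size D3) (noIsolated : NoIsolatedCycle G) where

  open Cycles G

  private
    t h : Arc G → Vertex G
    t = tail G
    h = head G

  too-many : (vs : List (Vertex G)) (as : List (Arc G)) → Unique vs → Unique as →
             10 ≤ length vs + length as → ⊥
  too-many vs as vs-unique as-unique 10≤ =
    1+n≰n (≤-trans 10≤ (≤-trans (distinct-count vs as vs-unique as-unique) G≤D3))

  HasTwoCycle : Set
  HasTwoCycle = ∃ λ x → ∃ λ y → h x ≡ t y × h y ≡ t x

  HasThreeCycle : Set
  HasThreeCycle = ∃ λ x → ∃ λ y → ∃ λ z → h x ≡ t y × h y ≡ t z × h z ≡ t x

  two-cycle? : Dec HasTwoCycle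
  two-cycle? = any? λ x → any? λ y → (h x ≟ t y) ×-dec (h y ≟ t x)

  three-cycle? : Dec HasThreeCycle
  three-cycle? = any? λ x → any? λ y → any? λ z → (h x ≟ t y) ×-dec (h y ≟ t z) ×-dec (h z ≟ t x)

  record Triangle : Set where
    field
      a b c : Vertex G
      A B C : Arc G
      A-joins : Joins G A a b
      B-joins : Joins G B b c
      C-joins : Joins G C c a

    tA : t A ≡ a
    tA = proj₁ A-joins
    hA : h A ≡ b
    hA = proj₂ A-joins
    tB : t B ≡ b
    tB = proj₁ B-joins
    hB : h B ≡ c
    hB = proj₂ B-joins
    tC : t C ≡ c
    tC = proj₁ C-joins
    hC : h C ≡ a
    hC = proj₂ C-joins

    Outside : Vertex G → Set
    Outside z = z ≢ a × z ≢ b × z ≢ c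

  rotate : Triangle → Triangle
  rotate T = record { a = b ; b = c ; c = a ; A = B ; B = C ; C = A
                    ; A-joins = B-joins ; B-joins = C-joins ; C-joins = A-joins }
    where open Triangle T

  module OnTriangle (no-two-cycle : ¬ HasTwoCycle) (T : Triangle) where
    open Triangle T

    a≢b : a ≢ b
    a≢b = Joins⇒≢ A-joins
    b≢c : b ≢ c
    b≢c = Joins⇒≢ B-joins
    c≢a : c ≢ a
    c≢a = Joins⇒≢ C-joins

    elementary : ElemCycle G (A ∷ B ∷ C ∷ [])
    elementary = triangle-elementary A-joins B-joins C-joins

    module Leaving {c'} (c'-elementary : ElemCycle G c') (avoids : Avoids c' A) where

      from-a : ∀ {s} → s ∈ c' → t s ≡ a → Outside (h s)
      from-a {s} s∈c' ts≡a with h s ≟ a | h s ≟ b | h s ≟ c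
      ... | yes hs≡a | _ | _ = contradiction (trans ts≡a (sym hs≡a)) (loopless G s)
      ... | no _ | yes hs≡b | _ =
            contradiction (trans ts≡a (sym tA) , trans hs≡b (sym hA)) (avoids s s∈c')
      ... | no _ | no _ | yes hs≡c =
            ⊥-elim (no-two-cycle (s , C , trans hs≡c (sym tC) , trans hC (sym ts≡a)))
      ... | no hs≢a | no hs≢b | no hs≢c = hs≢a , hs≢b , hs≢c

      from-c : ∀ {s} → s ∈ c' → t s ≡ c → ∃ λ s → s ∈ c' × Outside (h s)
      from-c {s} s∈c' ts≡c with h s ≟ c | h s ≟ b | h s ≟ a
      ... | yes hs≡c | _ | _ = contradiction (trans ts≡c (sym hs≡c)) (loopless G s)
      ... | no _ | yes hs≡b | _ =
            ⊥-elim (no-two-cycle (s , B , trans hs≡b (sym tB) , trans hB (sym ts≡c)))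
      ... | no _ | no _ | yes hs≡a =
            let s' , s'∈c' , hs≡ts' = successor c'-elementary s∈c'
            in s' , s'∈c' , from-a s'∈c' (trans (sym hs≡ts') hs≡a)
      ... | no hs≢c | no hs≢b | no hs≢a = s , s∈c' , hs≢a , hs≢b , hs≢c

      -- Without 2-cycles, arcs among the triangle's vertices are parallels of A, B, C, and following
      -- them from B or C leads to a parallel of A.
      leaves : ∀ {f} → f ∈ c' → f ∈ A ∷ B ∷ C ∷ [] → ∃ λ s → s ∈ c' × Outside (h s)
      leaves {f} f∈c' (here refl) = contradiction (refl , refl) (avoids f f∈c')
      leaves f∈c' (there (here refl)) =
        let s , s∈c' , hB≡ts = successor c'-elementary f∈c'
        in from-c s∈c' (trans (sym hB≡ts) hB)
      leaves f∈c' (there (there (here refl))) =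
        let s , s∈c' , hC≡ts = successor c'-elementary f∈c'
        in s , s∈c' , from-a s∈c' (trans (sym hC≡ts) hC)

    -- Triangle plus an outside vertex w, an arc s into w and an arc s' from w back to a already
    -- exhaust nine vertices and arcs; a cycle avoiding A must leave through s, return through s',
    -- and then has no way on from a but along a parallel of A.
    no-return-to-a : ∀ {s s' w} → h s ≡ w → Outside w → t s ≢ a → Joins G s' w a → ⊥
    no-return-to-a {s} {s'} {w} hs≡w (w≢a , w≢b , w≢c) ts≢a (ts'≡w , hs'≡a) =
      escape noIsolated elementary (here refl) λ (_ , c'-elementary , avoids , _ , f∈c' , f∈T) →
        let s₂ , s₂∈c' , hs₂-outside = Leaving.leaves c'-elementary avoids f∈c' f∈T
        in through-s c'-elementary avoids s₂∈c' hs₂-outside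
      where
      sixth-arc : ∀ {z} → A ≢ z → B ≢ z → C ≢ z → s ≢ z → s' ≢ z → ⊥
      sixth-arc A≢z B≢z C≢z s≢z s'≢z = too-many (a ∷ b ∷ c ∷ w ∷ []) (A ∷ B ∷ C ∷ s ∷ s' ∷ _ ∷ [])
        ((a≢b ∷ ≢-sym c≢a ∷ ≢-sym w≢a ∷ []) ∷ (b≢c ∷ ≢-sym w≢b ∷ []) ∷ (≢-sym w≢c ∷ []) ∷ [] ∷ [])
        ( (≢-by-tail tA tB a≢b ∷ ≢-by-tail tA tC (≢-sym c≢a)
            ∷ ≢-by-head hA hs≡w (≢-sym w≢b) ∷ ≢-by-tail tA ts'≡w (≢-sym w≢a) ∷ A≢z ∷ [])
        ∷ (≢-by-tail tB tC b≢c ∷ ≢-by-head hB hs≡w (≢-sym w≢c)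
            ∷ ≢-by-tail tB ts'≡w (≢-sym w≢b) ∷ B≢z ∷ [])
        ∷ (≢-by-head hC hs≡w (≢-sym w≢a) ∷ ≢-by-tail tC ts'≡w (≢-sym w≢c) ∷ C≢z ∷ [])
        ∷ (≢-by-head hs≡w hs'≡a w≢a ∷ s≢z ∷ [])
        ∷ (s'≢z ∷ [])
        ∷ [] ∷ [])
        ≤-refl

      through-s : ∀ {c'} → ElemCycle G c' → Avoids c' A → ∀ {s₂} → s₂ ∈ c' → Outside (h s₂) → ⊥
      through-s c'-elementary avoids {s₂} s₂∈c' (hs₂≢a , hs₂≢b , hs₂≢c) with s ≟ s₂
      ... | no s≢s₂ =
            sixth-arc (≢-by-head hA refl (≢-sym hs₂≢b)) (≢-by-head hB refl (≢-sym hs₂≢c))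
                      (≢-by-head hC refl (≢-sym hs₂≢a)) s≢s₂ (≢-by-head hs'≡a refl (≢-sym hs₂≢a))
      ... | yes refl with successor c'-elementary s₂∈c'
      ... | u , u∈c' , hs≡tu with trans (sym hs≡tu) hs≡w | s' ≟ u
      ...   | tu≡w | no s'≢u =
              sixth-arc (≢-by-tail tA tu≡w (≢-sym w≢a)) (≢-by-tail tB tu≡w (≢-sym w≢b))
                        (≢-by-tail tC tu≡w (≢-sym w≢c)) (λ { refl → loopless G s (sym hs≡tu) }) s'≢u
      ...   | _ | yes refl with successor c'-elementary u∈c'
      ...     | v , v∈c' , hs'≡tv with trans (sym hs'≡tv) hs'≡a | h v ≟ b
      ...       | tv≡a | yes hv≡b = avoids v v∈c' (trans tv≡a (sym tA) , trans hv≡b (sym hA))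
      ...       | tv≡a | no hv≢b =
                  sixth-arc (≢-by-head hA refl (≢-sym hv≢b)) (≢-by-tail tB tv≡a (≢-sym a≢b))
                            (≢-by-tail tC tv≡a c≢a) (≢-by-tail refl tv≡a ts≢a) (≢-by-tail ts'≡w tv≡a w≢a)

  ¬Triangle : ¬ HasTwoCycle → ¬ Triangle
  ¬Triangle no-two-cycle T =
    escape noIsolated elementary (here refl) λ (_ , c'-elementary , avoids , _ , f∈c' , f∈T) →
      let s , s∈c' , hs-outside = Leaving.leaves c'-elementary avoids f∈c' f∈T
          s' , _ , hs≡ts' = successor c'-elementary s∈c'
      in from-outside s s' hs≡ts' hs-outside
    where
    open Triangle T
    open OnTriangle no-two-cycle T

    no-way-back : ∀ {s s' z} → h s ≡ t s' → h s' ≡ z → t s ≢ z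
    no-way-back {s} {s'} hs≡ts' hs'≡z ts≡z = no-two-cycle (s , s' , hs≡ts' , trans hs'≡z (sym ts≡z))

    from-outside : ∀ s s' → h s ≡ t s' → Outside (h s) → ⊥
    from-outside s s' hs≡ts' hs-outside@(w≢a , w≢b , w≢c) with h s' ≟ a | h s' ≟ b | h s' ≟ c | h s' ≟ h s
    ... | yes hs'≡a | _ | _ | _ =
          no-return-to-a refl hs-outside (no-way-back hs≡ts' hs'≡a) (sym hs≡ts' , hs'≡a)
    ... | no _ | yes hs'≡b | _ | _ =
          OnTriangle.no-return-to-a no-two-cycle (rotate T) refl (w≢b , w≢c , w≢a) (no-way-back hs≡ts' hs'≡b)
            (sym hs≡ts' , hs'≡b)
    ... | no _ | no _ | yes hs'≡c | _ =
          OnTriangle.no-return-to-a no-two-cycle (rotate (rotate T)) refl (w≢c , w≢a , w≢b) (no-way-back hs≡ts' hs'≡c)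
            (sym hs≡ts' , hs'≡c)
    ... | no _ | no _ | no _ | yes hs'≡hs = loopless G s' (trans (sym hs≡ts') (sym hs'≡hs))
    ... | no x≢a | no x≢b | no x≢c | no x≢w =
          too-many (a ∷ b ∷ c ∷ h s ∷ h s' ∷ []) (A ∷ B ∷ C ∷ s ∷ s' ∷ [])
            ( (a≢b ∷ ≢-sym c≢a ∷ ≢-sym w≢a ∷ ≢-sym x≢a ∷ []) ∷ (b≢c ∷ ≢-sym w≢b ∷ ≢-sym x≢b ∷ [])
            ∷ (≢-sym w≢c ∷ ≢-sym x≢c ∷ []) ∷ (≢-sym x≢w ∷ []) ∷ [] ∷ [])
            ( (≢-by-tail tA tB a≢b ∷ ≢-by-tail tA tC (≢-sym c≢a)
                ∷ ≢-by-head hA refl (≢-sym w≢b) ∷ ≢-by-tail tA (sym hs≡ts') (≢-sym w≢a) ∷ [])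
            ∷ (≢-by-tail tB tC b≢c ∷ ≢-by-head hB refl (≢-sym w≢c)
                ∷ ≢-by-tail tB (sym hs≡ts') (≢-sym w≢b) ∷ [])
            ∷ (≢-by-head hC refl (≢-sym w≢a) ∷ ≢-by-tail tC (sym hs≡ts') (≢-sym w≢c) ∷ [])
            ∷ (≢-by-head refl refl (≢-sym x≢w) ∷ [])
            ∷ [] ∷ [])
            ≤-refl

  record Square : Set where
    field
      a b c d : Vertex G
      A B C D : Arc G
      A-joins : Joins G A a b
      B-joins : Joins G B b c
      C-joins : Joins G C c d
      D-joins : Joins G D d a

    tA : t A ≡ a
    tA = proj₁ A-joins
    hA : h A ≡ b
    hA = proj₂ A-joins
    tB : t B ≡ b
    tB = proj₁ B-joins
    hB : h B ≡ c
    hB = proj₂ B-joins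
    tC : t C ≡ c
    tC = proj₁ C-joins
    hC : h C ≡ d
    hC = proj₂ C-joins
    tD : t D ≡ d
    tD = proj₁ D-joins
    hD : h D ≡ a
    hD = proj₂ D-joins

  rotate-square : Square → Square
  rotate-square S = record { a = b ; b = c ; c = d ; d = a ; A = B ; B = C ; C = D ; D = A
                           ; A-joins = B-joins ; B-joins = C-joins ; C-joins = D-joins ; D-joins = A-joins }
    where open Square S

  module OnSquare (no-two-cycle : ¬ HasTwoCycle) (no-three-cycle : ¬ HasThreeCycle) (S : Square) where
    open Square S

    a≢b : a ≢ b
    a≢b = Joins⇒≢ A-joins
    b≢c : b ≢ c
    b≢c = Joins⇒≢ B-joins
    c≢d : c ≢ d
    c≢d = Joins⇒≢ C-joins
    d≢a : d ≢ a
    d≢a = Joins⇒≢ D-joins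
    a≢c : a ≢ c
    a≢c a≡c = no-two-cycle (A , B , trans hA (sym tB) , trans hB (trans (sym a≡c) (sym tA)))
    b≢d : b ≢ d
    b≢d b≡d = no-two-cycle (B , C , trans hB (sym tC) , trans hC (trans (sym b≡d) (sym tB)))

    onward : ∀ {s} → t s ≡ a → h s ≡ b
    onward {s} ts≡a with h s ≟ b | h s ≟ a | h s ≟ c | h s ≟ d
    ... | yes hs≡b | _ | _ | _ = hs≡b
    ... | no _ | yes hs≡a | _ | _ = contradiction (trans ts≡a (sym hs≡a)) (loopless G s)
    ... | no _ | no _ | yes hs≡c | _ =
          ⊥-elim (no-three-cycle (s , C , D , trans hs≡c (sym tC) , trans hC (sym tD) , trans hD (sym ts≡a)))
    ... | no _ | no _ | no _ | yes hs≡d =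
          ⊥-elim (no-two-cycle (s , D , trans hs≡d (sym tD) , trans hD (sym ts≡a)))
    ... | no x≢b | no x≢a | no x≢c | no x≢d = ⊥-elim (too-many (a ∷ b ∷ c ∷ d ∷ h s ∷ []) (A ∷ B ∷ C ∷ D ∷ s ∷ [])
          ( (a≢b ∷ a≢c ∷ ≢-sym d≢a ∷ ≢-sym x≢a ∷ [])
          ∷ (b≢c ∷ b≢d ∷ ≢-sym x≢b ∷ [])
          ∷ (c≢d ∷ ≢-sym x≢c ∷ [])
          ∷ (≢-sym x≢d ∷ []) ∷ [] ∷ [])
          ( (≢-by-tail tA tB a≢b ∷ ≢-by-tail tA tC a≢c ∷ ≢-by-tail tA tD (≢-sym d≢a) ∷ ≢-by-head hA refl (≢-sym x≢b) ∷ [])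
          ∷ (≢-by-tail tB tC b≢c ∷ ≢-by-tail tB tD b≢d ∷ ≢-by-tail tB ts≡a (≢-sym a≢b) ∷ [])
          ∷ (≢-by-tail tC tD c≢d ∷ ≢-by-tail tC ts≡a (≢-sym a≢c) ∷ [])
          ∷ (≢-by-tail tD ts≡a d≢a ∷ [])
          ∷ [] ∷ [])
          ≤-refl)

  module Circling (no-two-cycle : ¬ HasTwoCycle) (no-three-cycle : ¬ HasThreeCycle) (S : Square)
                  {c'} (c'-elementary : ElemCycle G c') (avoids : Avoids c' (Square.A S)) where
    open Square S

    onward : (S : Square) → ∀ {s} → t s ≡ Square.a S → h s ≡ Square.b S
    onward = OnSquare.onward no-two-cycle no-three-cycle

    enter-a : ∀ {x} → x ∈ c' → h x ≡ a → ⊥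
    enter-a x∈c' hx≡a =
      let s , s∈c' , hx≡ts = successor c'-elementary x∈c'
          ts≡a = trans (sym hx≡ts) hx≡a
      in avoids s s∈c' (trans ts≡a (sym tA) , trans (onward S ts≡a) (sym hA))

    enter-d : ∀ {x} → x ∈ c' → h x ≡ d → ⊥
    enter-d x∈c' hx≡d =
      let s , s∈c' , hx≡ts = successor c'-elementary x∈c'
      in enter-a s∈c' (onward (rotate-square (rotate-square (rotate-square S))) (trans (sym hx≡ts) hx≡d))

    enter-c : ∀ {x} → x ∈ c' → h x ≡ c → ⊥
    enter-c x∈c' hx≡c =
      let s , s∈c' , hx≡ts = successor c'-elementary x∈c'
      in enter-d s∈c' (onward (rotate-square (rotate-square S)) (trans (sym hx≡ts) hx≡c))

    meets-nowhere : ∀ {f} → f ∈ c' → ¬ f ∈ A ∷ B ∷ C ∷ D ∷ []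
    meets-nowhere {f} f∈c' (here refl) = avoids f f∈c' (refl , refl)
    meets-nowhere f∈c' (there (here refl)) = enter-c f∈c' hB
    meets-nowhere f∈c' (there (there (here refl))) = enter-d f∈c' hC
    meets-nowhere f∈c' (there (there (there (here refl)))) = enter-a f∈c' hD

  ¬ElemSquare : ¬ HasTwoCycle → ¬ HasThreeCycle → (S : Square) →
                ¬ ElemCycle G (Square.A S ∷ Square.B S ∷ Square.C S ∷ Square.D S ∷ [])
  ¬ElemSquare no-two-cycle no-three-cycle S S-elementary =
    escape noIsolated S-elementary (here refl) λ (_ , c'-elementary , avoids , _ , f∈c' , f∈S) →
      Circling.meets-nowhere no-two-cycle no-three-cycle S c'-elementary avoids f∈c' f∈S

  ¬ElemCycle : ¬ HasTwoCycle → ¬ HasThreeCycle → ∀ c → ¬ ElemCycle G c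
  ¬ElemCycle _ _ [] (() , _)
  ¬ElemCycle _ _ (x ∷ []) (hx≡tx , _) = loopless G x (sym hx≡tx)
  ¬ElemCycle no-two-cycle _ (x ∷ y ∷ []) ((hx≡ty , hy≡tx) , _) = no-two-cycle (x , y , hx≡ty , hy≡tx)
  ¬ElemCycle _ no-three-cycle (x ∷ y ∷ z ∷ []) ((hx≡ty , hy≡tz , hz≡tx) , _) =
    no-three-cycle (x , y , z , hx≡ty , hy≡tz , hz≡tx)
  ¬ElemCycle no-two-cycle no-three-cycle (A ∷ B ∷ C ∷ D ∷ []) S-elementary@((hA≡tB , hB≡tC , hC≡tD , hD≡tA) , _) =
    ¬ElemSquare no-two-cycle no-three-cycle
      (record { A-joins = refl , hA≡tB ; B-joins = refl , hB≡tC ; C-joins = refl , hC≡tD ; D-joins = refl , hD≡tA })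
      S-elementary
  ¬ElemCycle _ _ c@(_ ∷ _ ∷ _ ∷ _ ∷ _ ∷ _) (_ , tails-unique) =
    too-many (map t c) c tails-unique (map⁻ tails-unique) (+-mono-≤ five≤ five≤)
    where
    five≤ : ∀ {n} → 5 ≤ suc (suc (suc (suc (suc n))))
    five≤ = s≤s (s≤s (s≤s (s≤s (s≤s z≤n))))

  ¬Iso-D3⇒¬HasCycle : ¬ Iso G D3 → ¬ HasCycle G
  ¬Iso-D3⇒¬HasCycle not-D3 (c , c-elementary) with two-cycle? | three-cycle?
  ... | yes (x , y , hx≡ty , hy≡tx) | _ =
        two-cycle-detour noIsolated x-joins y-joins λ d₁ →
        two-cycle-detour noIsolated y-joins x-joins λ d₂ →
        not-D3 (two-cycle-detours⇒Iso-D3 G≤D3 x-joins y-joins d₁ d₂)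
    where
    x-joins : Joins G x (t x) (h x)
    x-joins = refl , refl
    y-joins : Joins G y (h x) (t x)
    y-joins = sym hx≡ty , hy≡tx
  ... | no no-two-cycle | yes (x , y , z , hx≡ty , hy≡tz , hz≡tx) =
        ¬Triangle no-two-cycle
          (record { A-joins = refl , hx≡ty ; B-joins = refl , hy≡tz ; C-joins = refl , hz≡tx })
  ... | no no-two-cycle | no no-three-cycle = ¬ElemCycle no-two-cycle no-three-cycle c c-elementary

proposition4 : HasCycle D3 × NoIsolatedCycle D3 ×
    (∀ (G : Digraph) → ¬ Iso G D3 → HasCycle G → NoIsolatedCycle G →
    size D3 < size G)
proposition4 = d3-has-cycle , d3-no-isolated-cycle , λ G not-D3 has-cycle noIsolated →
  ≰⇒> λ G≤D3 → Minimality.¬Iso-D3⇒¬HasCycle G≤D3 noIsolated not-D3 has-cycle
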